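{- Let $f:\mathbb{Z}_{>0}\to\mathbb{Q}_{>0}$ be defined by $f(2^k\ell)=\ell^{1-k}$ for all nonnegative integers $k,\ell$ with $\ell$ odd. Then for every positive integer $n$, the product $\prod_{r=1}^{n} f(r)$ is an integer.
   Context: Every positive integer is uniquely written as $2^k\ell$ with $k\ge 0$ and $\ell$ odd, so $f$ is well defined. For example $f(1)=1$, $f(2)=1$, $f(3)=3$, $f(12)=1/3$. -}

module Defs where

open import Data.Nat as ℕ using (ℕ; zero; suc; _^_; NonZero)
open import Data.Nat.Properties using (m^n≢0)
open import Data.Nat.DivMod using (_/_; _%_)
open import Data.Product using (_×_; _,_; proj₁; proj₂)
open import Data.Integer using (ℤ; +_)
open import Data.Rational as ℚ using (ℚ)
open import Data.List using (List; foldr; map)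
open import Data.List using (upTo)

-- split2 fuel m = (k , ℓ) with m = 2^k * ℓ, ℓ odd (for m ≥ 1 and fuel ≥ m)
split2 : ℕ → ℕ → ℕ × ℕ
split2 zero    m = 0 , m
split2 (suc f) m with m % 2 | m
... | _ | zero = 0 , 0
... | zero | suc _ = let r = split2 f (m / 2) in suc (proj₁ r) , proj₂ r
... | suc _ | suc _ = 0 , m

v2 : ℕ → ℕ
v2 m = proj₁ (split2 m m)

oddPart : ℕ → ℕ
oddPart m = proj₂ (split2 m m)

powOneMinus : (ℓ k : ℕ) → .{{NonZero ℓ}} → ℚ
powOneMinus ℓ zero          = (+ ℓ) ℚ./ 1
powOneMinus ℓ (suc zero)    = ℚ.1ℚ
powOneMinus ℓ (suc (suc j)) = (+ 1) ℚ./ (ℓ ^ suc j)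
  where instance _ = m^n≢0 ℓ (suc j)

-- f(2^k ℓ) = ℓ^(1-k); f(0) is irrelevant (junk value 1)
f : ℕ → ℚ
f m with oddPart m
... | zero  = ℚ.1ℚ
... | suc j = powOneMinus (suc j) (v2 m)

prodF : ℕ → ℚ
prodF n = foldr ℚ._*_ ℚ.1ℚ (map (λ i → f (suc i)) (upTo n))

module Submission where

open import Defs
open import Data.Nat using (ℕ; suc)
open import Data.Integer using (ℤ)
open import Data.Rational using (ℚ; _/_)
open import Data.Product using (∃)
open import Relation.Binary.PropositionalEquality using (_≡_)

-- Write r = 2^(k_r) ℓ_r with ℓ_r odd.  Since f(r) = ℓ_r / ℓ_r^(k_r), the product
-- ∏_{r ≤ n} f(r) equals T(n) / D(n), where T(n) = ∏_{r ≤ n} ℓ_r is the odd part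
-- of n! and D(n) = ∏_{r ≤ n} ℓ_r^(k_r).  So it suffices to show D(n) ∣ T(n).
--
-- Odd r contribute ℓ_r^0 = 1 to D, and ℓ_(2s) = ℓ_s, k_(2s) = k_s + 1, hence
-- D(2m) = D(2m+1) = T(m) · D(m).  Moreover T(a) · T(b) ∣ T(a+b), because it is the
-- odd part of a! · b!, which divides (a+b)!.  By induction on halving,
--   D(2m) = T(m) · D(m) ∣ T(m) · T(m) ∣ T(2m) ∣ T(2m+1).

module OddParts where

  open import Data.Nat renaming (_/_ to _/ℕ_)
  open import Data.Nat.Properties
  open import Data.Nat.DivMod using ([m+kn]%n≡m%n; m*n%n≡0; m*n/n≡m; m/n<m)
  open import Data.Nat.Divisibility
  open import Data.Nat.Induction using (<-rec)
  open import Data.Nat.Primality using (prime[2]; euclidsLemma; prime⇒irreducible)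
  open import Data.Nat.Coprimality using (Coprime; coprime-divisor)
  open import Data.Nat.Combinatorics using (k![n∸k]!∣n!)
  open import Data.Product using (_,_; proj₁; proj₂)
  open import Data.Sum using (inj₁; inj₂; [_,_]′)
  open import Relation.Nullary using (contradiction)
  open import Relation.Binary.PropositionalEquality
  import Algebra.Properties.CommutativeSemigroup *-commutativeSemigroup as ℕ-*

  [2m]%2≡0 : ∀ m → 2 * m % 2 ≡ 0
  [2m]%2≡0 m = trans (cong (_% 2) (*-comm 2 m)) (m*n%n≡0 m 2)

  [1+2m]%2≡1 : ∀ m → suc (2 * m) % 2 ≡ 1
  [1+2m]%2≡1 m = trans (cong (λ x → suc x % 2) (*-comm 2 m)) ([m+kn]%n≡m%n 1 m 2)

  [2m]/2≡m : ∀ m → 2 * m /ℕ 2 ≡ m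
  [2m]/2≡m m = trans (cong (_/ℕ 2) (*-comm 2 m)) (m*n/n≡m m 2)

  data EvenOdd : ℕ → Set where
    even : ∀ m → EvenOdd (2 * m)
    odd  : ∀ m → EvenOdd (suc (2 * m))

  evenOdd : ∀ n → EvenOdd n
  evenOdd zero = even 0
  evenOdd (suc n) with evenOdd n
  ... | even m = odd m
  ... | odd m  = subst EvenOdd (*-suc 2 m) (even (suc m))

  halving-ind : (P : ℕ → Set) → P 0 →
    (∀ m → P (suc m) → P (2 * suc m)) → (∀ m → P m → P (suc (2 * m))) → ∀ n → P n
  halving-ind P base double double+1 = <-rec P step
    where
    step : ∀ n → (∀ {k} → k < n → P k) → P n
    step n rec with evenOdd n
    ... | even zero    = base
    ... | even (suc m) = double m (rec (subst (suc m <_) (*-comm (suc m) 2) (m<m*n (suc m) 2 ≤-refl)))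
    ... | odd m        = double+1 m (rec (s≤s (m≤n*m m 2)))

  Odd : ℕ → Set
  Odd n = 2 ∤ n

  odd-double+1 : ∀ m → Odd (suc (2 * m))
  odd-double+1 m 2∣ with trans (sym ([1+2m]%2≡1 m)) (n∣m⇒m%n≡0 _ 2 2∣)
  ... | ()

  odd-* : ∀ {a b} → Odd a → Odd b → Odd (a * b)
  odd-* {a} {b} odd-a odd-b 2∣ab = [ odd-a , odd-b ]′ (euclidsLemma a b prime[2] 2∣ab)

  odd⇒coprime-2 : ∀ {x} → Odd x → Coprime x 2
  odd⇒coprime-2 odd-x (d∣x , d∣2) with prime⇒irreducible prime[2] d∣2
  ... | inj₁ d≡1  = d≡1
  ... | inj₂ refl = contradiction d∣x odd-x

  odd-cancel-2^ : ∀ {x y} e → Odd x → x ∣ 2 ^ e * y → x ∣ y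
  odd-cancel-2^ {x} {y} zero    _     x∣ = subst (x ∣_) (+-identityʳ y) x∣
  odd-cancel-2^ {x} {y} (suc e) odd-x x∣ = odd-cancel-2^ e odd-x
    (coprime-divisor (odd⇒coprime-2 odd-x) (subst (x ∣_) (*-assoc 2 (2 ^ e) y) x∣))

  split2-odd : ∀ fuel m → split2 (suc fuel) (suc (2 * m)) ≡ (0 , suc (2 * m))
  split2-odd fuel m rewrite [1+2m]%2≡1 m = refl

  split2-even : ∀ fuel m →
    split2 (suc fuel) (2 * suc m) ≡ (suc (proj₁ (split2 fuel (suc m))) , proj₂ (split2 fuel (suc m)))
  split2-even fuel m rewrite [2m]%2≡0 (suc m) | [2m]/2≡m (suc m) = refl

  split2-fuel : ∀ f g m → m ≤ f → f ≤ g → split2 f m ≡ split2 g m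
  split2-fuel zero    zero    zero    _ _ = refl
  split2-fuel zero    (suc g) zero    _ _ = refl
  split2-fuel (suc f) (suc g) zero    _ _ = refl
  split2-fuel (suc f) (suc g) (suc m) (s≤s m≤f) (s≤s f≤g) with suc m % 2
  ... | zero  = cong (λ r → suc (proj₁ r) , proj₂ r)
                     (split2-fuel f g (suc m /ℕ 2) (≤-trans half≤m m≤f) f≤g)
    where
    half≤m : suc m /ℕ 2 ≤ m
    half≤m = ≤-pred (m/n<m (suc m) 2 (s≤s (s≤s z≤n)))
  ... | suc _ = refl

  split2-double : ∀ m → split2 (2 * suc m) (2 * suc m) ≡ (suc (v2 (suc m)) , oddPart (suc m))
  split2-double m = begin
    split2 (2 * suc m) (2 * suc m)                                    ≡⟨ split2-even fuel m ⟩
    (suc (proj₁ (split2 fuel (suc m))) , proj₂ (split2 fuel (suc m)))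
      ≡⟨ cong (λ r → suc (proj₁ r) , proj₂ r) (sym (split2-fuel (suc m) fuel (suc m) ≤-refl suc[m]≤fuel)) ⟩
    (suc (v2 (suc m)) , oddPart (suc m))                              ∎
    where
    open ≡-Reasoning
    -- 2 * suc m unfolds to suc fuel
    fuel : ℕ
    fuel = m + (suc m + 0)
    suc[m]≤fuel : suc m ≤ fuel
    suc[m]≤fuel = ≤-trans (m≤n+m (suc m) m) (≤-reflexive (cong (m +_) (sym (+-identityʳ (suc m)))))

  v2-double+1 : ∀ m → v2 (suc (2 * m)) ≡ 0
  v2-double+1 m = cong proj₁ (split2-odd (2 * m) m)

  oddPart-double+1 : ∀ m → oddPart (suc (2 * m)) ≡ suc (2 * m)
  oddPart-double+1 m = cong proj₂ (split2-odd (2 * m) m)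

  v2-double : ∀ m → v2 (2 * suc m) ≡ suc (v2 (suc m))
  v2-double m = cong proj₁ (split2-double m)

  oddPart-double : ∀ m → oddPart (2 * suc m) ≡ oddPart (suc m)
  oddPart-double m = cong proj₂ (split2-double m)

  oddPart-decomposition : ∀ n → oddPart n * 2 ^ v2 n ≡ n
  oddPart-decomposition = halving-ind (λ n → oddPart n * 2 ^ v2 n ≡ n) refl double double+1
    where
    open ≡-Reasoning
    double : ∀ m → oddPart (suc m) * 2 ^ v2 (suc m) ≡ suc m →
             oddPart (2 * suc m) * 2 ^ v2 (2 * suc m) ≡ 2 * suc m
    double m ih = begin
      oddPart (2 * suc m) * 2 ^ v2 (2 * suc m)  ≡⟨ cong₂ (λ ℓ k → ℓ * 2 ^ k) (oddPart-double m) (v2-double m) ⟩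
      oddPart (suc m) * (2 * 2 ^ v2 (suc m))    ≡⟨ ℕ-*.x∙yz≈y∙xz (oddPart (suc m)) 2 _ ⟩
      2 * (oddPart (suc m) * 2 ^ v2 (suc m))    ≡⟨ cong (2 *_) ih ⟩
      2 * suc m                                  ∎
    double+1 : ∀ m → oddPart m * 2 ^ v2 m ≡ m →
               oddPart (suc (2 * m)) * 2 ^ v2 (suc (2 * m)) ≡ suc (2 * m)
    double+1 m _ = begin
      oddPart (suc (2 * m)) * 2 ^ v2 (suc (2 * m))  ≡⟨ cong₂ (λ ℓ k → ℓ * 2 ^ k) (oddPart-double+1 m) (v2-double+1 m) ⟩
      suc (2 * m) * 1                                ≡⟨ *-identityʳ (suc (2 * m)) ⟩
      suc (2 * m)                                    ∎

  oddPart-odd : ∀ n → Odd (oddPart (suc n))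
  oddPart-odd n = halving-ind P (λ ()) double double+1 (suc n) (s≤s z≤n)
    where
    P : ℕ → Set
    P n = 0 < n → Odd (oddPart n)
    double : ∀ m → P (suc m) → P (2 * suc m)
    double m ih _ = subst Odd (sym (oddPart-double m)) (ih (s≤s z≤n))
    double+1 : ∀ m → P m → P (suc (2 * m))
    double+1 m _ _ = subst Odd (sym (oddPart-double+1 m)) (odd-double+1 m)

  -- T(n) = ∏_{r ≤ n} ℓ_r, the sum ∑_{r ≤ n} k_r, and D(n) = ∏_{r ≤ n} ℓ_r^(k_r).

  oddProd : ℕ → ℕ
  oddProd zero    = 1
  oddProd (suc n) = oddProd n * oddPart (suc n)

  v2Sum : ℕ → ℕ
  v2Sum zero    = 0
  v2Sum (suc n) = v2Sum n + v2 (suc n)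

  powProd : ℕ → ℕ
  powProd zero    = 1
  powProd (suc n) = powProd n * oddPart (suc n) ^ v2 (suc n)

  oddProd-factorial : ∀ n → oddProd n * 2 ^ v2Sum n ≡ n !
  oddProd-factorial zero    = refl
  oddProd-factorial (suc n) = begin
    oddProd n * ℓ * 2 ^ (v2Sum n + k)        ≡⟨ cong (oddProd n * ℓ *_) (^-distribˡ-+-* 2 (v2Sum n) k) ⟩
    oddProd n * ℓ * (2 ^ v2Sum n * 2 ^ k)    ≡⟨ ℕ-*.interchange (oddProd n) ℓ _ _ ⟩
    oddProd n * 2 ^ v2Sum n * (ℓ * 2 ^ k)    ≡⟨ cong₂ _*_ (oddProd-factorial n) (oddPart-decomposition (suc n)) ⟩
    n ! * suc n                              ≡⟨ *-comm (n !) (suc n) ⟩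
    suc n !                                  ∎
    where
    open ≡-Reasoning
    ℓ = oddPart (suc n)
    k = v2 (suc n)

  oddProd-odd : ∀ n → Odd (oddProd n)
  oddProd-odd zero    = odd-double+1 0
  oddProd-odd (suc n) = odd-* (oddProd-odd n) (oddPart-odd n)

  -- T(a) · T(b) ∣ T(a + b): the odd part of a! · b! divides the odd part of (a+b)!.
  oddProd-binomial : ∀ a b → oddProd a * oddProd b ∣ oddProd (a + b)
  oddProd-binomial a b = odd-cancel-2^ (v2Sum (a + b)) (odd-* (oddProd-odd a) (oddProd-odd b)) (begin
    oddProd a * oddProd b                               ∣⟨ m∣m*n (2 ^ (v2Sum a + v2Sum b)) ⟩
    oddProd a * oddProd b * 2 ^ (v2Sum a + v2Sum b)     ≡⟨ cong (oddProd a * oddProd b *_) (^-distribˡ-+-* 2 (v2Sum a) (v2Sum b)) ⟩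
    oddProd a * oddProd b * (2 ^ v2Sum a * 2 ^ v2Sum b) ≡⟨ ℕ-*.interchange (oddProd a) _ _ _ ⟩
    oddProd a * 2 ^ v2Sum a * (oddProd b * 2 ^ v2Sum b) ≡⟨ cong₂ _*_ (oddProd-factorial a) (oddProd-factorial b) ⟩
    a ! * b !                                           ∣⟨ subst (λ c → a ! * c ! ∣ (a + b) !) (m+n∸m≡n a b) (k![n∸k]!∣n! (m≤m+n a b)) ⟩
    (a + b) !                                           ≡⟨ sym (oddProd-factorial (a + b)) ⟩
    oddProd (a + b) * 2 ^ v2Sum (a + b)                 ≡⟨ *-comm (oddProd (a + b)) _ ⟩
    2 ^ v2Sum (a + b) * oddProd (a + b)                 ∎)
    where open ∣-Reasoning

  powProd-double+1 : ∀ m → powProd (suc (2 * m)) ≡ powProd (2 * m)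
  powProd-double+1 m = begin
    powProd (2 * m) * oddPart (suc (2 * m)) ^ v2 (suc (2 * m))  ≡⟨ cong (λ k → powProd (2 * m) * oddPart (suc (2 * m)) ^ k) (v2-double+1 m) ⟩
    powProd (2 * m) * 1                                        ≡⟨ *-identityʳ (powProd (2 * m)) ⟩
    powProd (2 * m)                                            ∎
    where open ≡-Reasoning

  -- D(2m) = T(m) · D(m), since ℓ_(2s)^(k_(2s)) = ℓ_s · ℓ_s^(k_s).
  powProd-double : ∀ m → powProd (2 * m) ≡ oddProd m * powProd m
  powProd-double zero    = refl
  powProd-double (suc m) = begin
    powProd (2 * suc m)                                          ≡⟨ cong powProd (*-suc 2 m) ⟩
    powProd (suc (2 * m)) * oddPart (2 + 2 * m) ^ v2 (2 + 2 * m) ≡⟨ cong (λ x → powProd (suc (2 * m)) * oddPart x ^ v2 x) (sym (*-suc 2 m)) ⟩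
    powProd (suc (2 * m)) * oddPart (2 * suc m) ^ v2 (2 * suc m) ≡⟨ cong₂ _*_ (powProd-double+1 m) (cong₂ _^_ (oddPart-double m) (v2-double m)) ⟩
    powProd (2 * m) * (ℓ * ℓ ^ k)                                ≡⟨ cong (_* (ℓ * ℓ ^ k)) (powProd-double m) ⟩
    oddProd m * powProd m * (ℓ * ℓ ^ k)                          ≡⟨ ℕ-*.interchange (oddProd m) (powProd m) ℓ (ℓ ^ k) ⟩
    oddProd m * ℓ * (powProd m * ℓ ^ k)                          ∎
    where
    open ≡-Reasoning
    ℓ = oddPart (suc m)
    k = v2 (suc m)

  powProd∣oddProd : ∀ n → powProd n ∣ oddProd n
  powProd∣oddProd = halving-ind (λ n → powProd n ∣ oddProd n) ∣-refl (λ m → doubling (suc m)) double+1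
    where
    open ∣-Reasoning
    doubling : ∀ m → powProd m ∣ oddProd m → powProd (2 * m) ∣ oddProd (2 * m)
    doubling m ih = begin
      powProd (2 * m)         ≡⟨ powProd-double m ⟩
      oddProd m * powProd m   ∣⟨ *-monoʳ-∣ (oddProd m) ih ⟩
      oddProd m * oddProd m   ∣⟨ oddProd-binomial m m ⟩
      oddProd (m + m)         ≡⟨ cong (λ x → oddProd (m + x)) (sym (+-identityʳ m)) ⟩
      oddProd (2 * m)         ∎
    double+1 : ∀ m → powProd m ∣ oddProd m → powProd (suc (2 * m)) ∣ oddProd (suc (2 * m))
    double+1 m ih = begin
      powProd (suc (2 * m))   ≡⟨ powProd-double+1 m ⟩
      powProd (2 * m)         ∣⟨ doubling m ih ⟩
      oddProd (2 * m)         ∣⟨ m∣m*n (oddPart (suc (2 * m))) ⟩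
      oddProd (suc (2 * m))   ∎

open OddParts using (oddPart-odd; oddProd; powProd; oddProd-odd; powProd∣oddProd)

open import Data.Nat using (zero; NonZero; ≢-nonZero)
import Data.Nat as ℕ
import Data.Nat.Properties as ℕ
open import Data.Nat.Divisibility using (_∣_; divides; _∣0; 0∣⇒≡0)
open import Data.Integer using (+_)
import Data.Integer.Properties as ℤ
open import Data.Rational using (_*_; 1ℚ; 1/_; fromℚᵘ) renaming (NonZero to NonZeroℚ)
open import Data.Rational.Properties
  using (toℚᵘ-injective; toℚᵘ-fromℚᵘ; toℚᵘ-homo-*; fromℚᵘ-cong; *-assoc; *-identityˡ; *-identityʳ;
         *-inverseʳ; normalize-pos; pos⇒nonZero; *-1-commutativeMonoid)
import Data.Rational.Unnormalised as ℚᵘ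
import Data.Rational.Unnormalised.Properties as ℚᵘ
open import Data.List using ([]; _∷_; foldr; map; upTo; _++_; [_])
open import Data.List.Properties using (upTo-∷ʳ; map-++; foldr-++)
open import Data.Product using (_,_)
open import Relation.Binary.PropositionalEquality using (sym; trans; cong; cong₂; subst; module ≡-Reasoning)
open import Relation.Nullary using (contradiction)
open import Algebra.Bundles using (CommutativeMonoid)
open import Algebra.Properties.CommutativeSemigroup (CommutativeMonoid.commutativeSemigroup *-1-commutativeMonoid)
  using (interchange)

fromℕ : ℕ → ℚ
fromℕ n = + n / 1

fromℚᵘ-homo-* : ∀ x y → fromℚᵘ (x ℚᵘ.* y) ≡ fromℚᵘ x * fromℚᵘ y
fromℚᵘ-homo-* x y = toℚᵘ-injective (ℚᵘ.≃-trans (toℚᵘ-fromℚᵘ (x ℚᵘ.* y))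
  (ℚᵘ.≃-trans (ℚᵘ.*-cong (ℚᵘ.≃-sym (toℚᵘ-fromℚᵘ x)) (ℚᵘ.≃-sym (toℚᵘ-fromℚᵘ y)))
              (ℚᵘ.≃-sym (toℚᵘ-homo-* (fromℚᵘ x) (fromℚᵘ y)))))

/-homo-* : ∀ a b c d .{{_ : NonZero b}} .{{_ : NonZero d}} →
  ((+ (a ℕ.* c)) / (b ℕ.* d)) {{ℕ.m*n≢0 b d}} ≡ (+ a / b) * (+ c / d)
/-homo-* a (suc b) c (suc d) =
  trans (cong (λ n → (n / (suc b ℕ.* suc d)) {{ℕ.m*n≢0 (suc b) (suc d)}}) (ℤ.pos-* a c))
        (fromℚᵘ-homo-* (ℚᵘ.mkℚᵘ (+ a) b) (ℚᵘ.mkℚᵘ (+ c) d))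

/-cross : ∀ a b c d .{{_ : NonZero b}} .{{_ : NonZero d}} → a ℕ.* d ≡ c ℕ.* b → + a / b ≡ + c / d
/-cross a (suc b) c (suc d) eq = fromℚᵘ-cong {ℚᵘ.mkℚᵘ (+ a) b} {ℚᵘ.mkℚᵘ (+ c) d}
  (ℚᵘ.*≡* (trans (sym (ℤ.pos-* a (suc d))) (trans (cong +_ eq) (ℤ.pos-* c (suc b)))))

fromℕ-* : ∀ a b → fromℕ (a ℕ.* b) ≡ fromℕ a * fromℕ b
fromℕ-* a b = /-homo-* a 1 b 1

fromℕ-nonZero : ∀ n .{{_ : NonZero n}} → NonZeroℚ (fromℕ n)
fromℕ-nonZero (suc n) = pos⇒nonZero (fromℕ (suc n)) {{normalize-pos (suc n) 1}}

*-cancelʳ : ∀ p q r .{{_ : NonZeroℚ r}} → p * r ≡ q * r → p ≡ q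
*-cancelʳ p q r pr≡qr = begin
  p                ≡⟨ sym (*-identityʳ p) ⟩
  p * 1ℚ           ≡⟨ cong (p *_) (sym (*-inverseʳ r)) ⟩
  p * (r * 1/ r)   ≡⟨ sym (*-assoc p r (1/ r)) ⟩
  p * r * 1/ r     ≡⟨ cong (_* 1/ r) pr≡qr ⟩
  q * r * 1/ r     ≡⟨ *-assoc q r (1/ r) ⟩
  q * (r * 1/ r)   ≡⟨ cong (q *_) (*-inverseʳ r) ⟩
  q * 1ℚ           ≡⟨ *-identityʳ q ⟩
  q                ∎
  where open ≡-Reasoning

powOneMinus-spec : ∀ ℓ k .{{_ : NonZero ℓ}} → powOneMinus ℓ k * fromℕ (ℓ ℕ.^ k) ≡ fromℕ ℓ
powOneMinus-spec ℓ zero                  = *-identityʳ (fromℕ ℓ)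
powOneMinus-spec ℓ (suc zero)            = trans (*-identityˡ _) (cong fromℕ (ℕ.*-identityʳ ℓ))
powOneMinus-spec ℓ@(suc _) (suc (suc j)) =
  trans (sym (/-homo-* 1 (ℓ ℕ.^ suc j) (ℓ ℕ.^ suc (suc j)) 1 {{ℕ.m^n≢0 ℓ (suc j)}}))
        (/-cross (1 ℕ.* ℓ ℕ.^ suc (suc j)) (ℓ ℕ.^ suc j ℕ.* 1) ℓ 1 {{ℕ.m*n≢0 (ℓ ℕ.^ suc j) 1 {{ℕ.m^n≢0 ℓ (suc j)}}}} cross)
  where
  open ≡-Reasoning
  cross : 1 ℕ.* ℓ ℕ.^ suc (suc j) ℕ.* 1 ≡ ℓ ℕ.* (ℓ ℕ.^ suc j ℕ.* 1)
  cross = begin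
    1 ℕ.* ℓ ℕ.^ suc (suc j) ℕ.* 1  ≡⟨ ℕ.*-identityʳ _ ⟩
    1 ℕ.* ℓ ℕ.^ suc (suc j)        ≡⟨ ℕ.*-identityˡ _ ⟩
    ℓ ℕ.* ℓ ℕ.^ suc j              ≡⟨ cong (ℓ ℕ.*_) (sym (ℕ.*-identityʳ _)) ⟩
    ℓ ℕ.* (ℓ ℕ.^ suc j ℕ.* 1)      ∎

-- f(r) · ℓ_r^(k_r) = ℓ_r; the odd part ℓ_r is nonzero, so f takes its main branch.
f-spec : ∀ m → f (suc m) * fromℕ (oddPart (suc m) ℕ.^ v2 (suc m)) ≡ fromℕ (oddPart (suc m))
f-spec m with oddPart (suc m) | oddPart-odd m
... | zero  | odd-0 = contradiction (2 ∣0) odd-0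
... | suc j | _     = powOneMinus-spec (suc j) (v2 (suc m))

foldr-*-init : ∀ xs y → foldr _*_ y xs ≡ foldr _*_ 1ℚ xs * y
foldr-*-init []       y = sym (*-identityˡ y)
foldr-*-init (x ∷ xs) y = trans (cong (x *_) (foldr-*-init xs y)) (sym (*-assoc x _ y))

prodF-suc : ∀ n → prodF (suc n) ≡ prodF n * f (suc n)
prodF-suc n = begin
  foldr _*_ 1ℚ (map g (upTo (suc n)))       ≡⟨ cong (λ l → foldr _*_ 1ℚ (map g l)) (sym (upTo-∷ʳ n)) ⟩
  foldr _*_ 1ℚ (map g (upTo n ++ [ n ]))    ≡⟨ cong (foldr _*_ 1ℚ) (map-++ g (upTo n) [ n ]) ⟩
  foldr _*_ 1ℚ (map g (upTo n) ++ [ g n ])  ≡⟨ foldr-++ _*_ 1ℚ (map g (upTo n)) [ g n ] ⟩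
  foldr _*_ (g n * 1ℚ) (map g (upTo n))     ≡⟨ foldr-*-init (map g (upTo n)) _ ⟩
  prodF n * (g n * 1ℚ)                      ≡⟨ cong (prodF n *_) (*-identityʳ (g n)) ⟩
  prodF n * f (suc n)                       ∎
  where
  open ≡-Reasoning
  g : ℕ → ℚ
  g i = f (suc i)

prodF-quotient : ∀ n → prodF n * fromℕ (powProd n) ≡ fromℕ (oddProd n)
prodF-quotient zero    = *-identityˡ 1ℚ
prodF-quotient (suc n) = begin
  prodF (suc n) * fromℕ (powProd n ℕ.* t)             ≡⟨ cong₂ _*_ (prodF-suc n) (fromℕ-* (powProd n) t) ⟩
  prodF n * f (suc n) * (fromℕ (powProd n) * fromℕ t) ≡⟨ interchange (prodF n) _ _ _ ⟩
  prodF n * fromℕ (powProd n) * (f (suc n) * fromℕ t) ≡⟨ cong₂ _*_ (prodF-quotient n) (f-spec n) ⟩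
  fromℕ (oddProd n) * fromℕ (oddPart (suc n))         ≡⟨ sym (fromℕ-* (oddProd n) _) ⟩
  fromℕ (oddProd (suc n))                             ∎
  where
  open ≡-Reasoning
  t = oddPart (suc n) ℕ.^ v2 (suc n)

-- D(n) ≠ 0, as it divides the odd number T(n).
powProd-nonZero : ∀ n → NonZero (powProd n)
powProd-nonZero n = ≢-nonZero λ powProd≡0 →
  oddProd-odd n (subst (2 ∣_) (sym (0∣⇒≡0 (subst (_∣ oddProd n) powProd≡0 (powProd∣oddProd n)))) (2 ∣0))

-- Writing T = q · D, the product ∏ f(r) = T / D is the integer q.
theorem1 : (n : ℕ) → ∃ λ (z : ℤ) → prodF (suc n) ≡ z / 1
theorem1 n with powProd∣oddProd (suc n)
... | divides q T≡q*D = + q , *-cancelʳ (prodF (suc n)) (fromℕ q) (fromℕ D) (begin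
  prodF (suc n) * fromℕ D   ≡⟨ prodF-quotient (suc n) ⟩
  fromℕ (oddProd (suc n))   ≡⟨ cong fromℕ T≡q*D ⟩
  fromℕ (q ℕ.* D)           ≡⟨ fromℕ-* q D ⟩
  fromℕ q * fromℕ D         ∎)
  where
  open ≡-Reasoning
  D = powProd (suc n)
  instance
    D≢0 : NonZero D
    D≢0 = powProd-nonZero (suc n)
    fromℕ[D]≢0 : NonZeroℚ (fromℕ D)
    fromℕ[D]≢0 = fromℕ-nonZero D
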